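{- Suppose there exist a resolvable $(v,b,r,k,\lambda)$-BIBD and a $3$-$(w,w/2,\lambda')$-design, where $w=v/k>4$ is even. Then there exists a $3$-$(v,v/2,\mu)$-design, where \[ \mu = \lambda'\left(\frac{3\lambda w}{w-4}+r\right). \]
   Context: A $(v,b,r,k,\lambda)$-BIBD is a pair $(X,\mathcal{B})$ with $|X|=v$ and $\mathcal{B}$ a multiset of $b$ subsets of $X$ of size $k$ ($2\le k<v$) such that every point lies in exactly $r$ blocks and every pair of distinct points lies in exactly $\lambda$ blocks. It is resolvable if $k\mid v$ and $\mathcal{B}$ can be partitioned into $r$ classes, each consisting of $v/k$ pairwise disjoint blocks. For $t\le k<v$, a $t$-$(v,k,\lambda)$-design is a pair $(X,\mathcal{B})$ with $|X|=v$ and $\mathcal{B}$ a multiset of $k$-subsets of $X$ such that every $t$-subset of $X$ lies in exactly $\lambda$ blocks. -}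

module Defs where

open import Data.Nat using (ℕ; _*_; _≤_; _<_)
open import Data.Nat.Divisibility using (_∣_)
open import Data.Fin using (Fin)
open import Data.Fin.Subset using (Subset; ⁅_⁆; _∪_; _∩_; ⊥; ∣_∣)
open import Data.Fin.Subset.Properties using (_⊆?_)
open import Data.List using (List; length; filter; concat)
open import Data.List.Relation.Unary.All using (All)
open import Data.List.Relation.Unary.AllPairs using (AllPairs)
open import Data.List.Relation.Binary.Permutation.Propositional using (_↭_)
open import Relation.Binary.PropositionalEquality using (_≡_; _≢_)

Block : ℕ → Set
Block v = Subset v

count : {v : ℕ} → Subset v → List (Subset v) → ℕ
count S Bs = length (filter (S ⊆?_) Bs)

-- A (v,b,r,k,λ)-BIBD on X = Fin v; the multiset of blocks is a list.
record BIBD (v b r k lam : ℕ) : Set where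
  field
    blocks     : List (Subset v)
    k≥2        : 2 ≤ k
    k<v        : k < v
    numBlocks  : length blocks ≡ b
    blockSize  : All (λ B → ∣ B ∣ ≡ k) blocks
    replication : (x : Fin v) → count ⁅ x ⁆ blocks ≡ r
    balance    : (x y : Fin v) → x ≢ y → count (⁅ x ⁆ ∪ ⁅ y ⁆) blocks ≡ lam

Disjoint : {v : ℕ} → Subset v → Subset v → Set
Disjoint B C = B ∩ C ≡ ⊥

-- A resolvable BIBD: k ∣ v and the block multiset is partitioned into r
-- classes, each consisting of v/k pairwise disjoint blocks
-- (class size written as  length cls * k ≡ v , i.e. length cls = v/k).
record ResolvableBIBD (v b r k lam : ℕ) : Set where
  field
    design      : BIBD v b r k lam
    k∣v         : k ∣ v
    classes     : List (List (Subset v))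
    numClasses  : length classes ≡ r
    classSize   : All (λ cls → length cls * k ≡ v) classes
    classDisj   : All (AllPairs Disjoint) classes
    partition   : concat classes ↭ BIBD.blocks design

record TDesign (t v k lam : ℕ) : Set where
  field
    blocks    : List (Subset v)
    t≤k       : t ≤ k
    k<v       : k < v
    blockSize : All (λ B → ∣ B ∣ ≡ k) blocks
    balance   : (S : Subset v) → ∣ S ∣ ≡ t → count S blocks ≡ lam

module Submission where

-- Each resolution class of the BIBD splits the v points into w parts of size k, so it is the
-- family of fibres of a map p : Fin v → Fin w.  Pulling every block D of the 3-(w, w/2, λ′)
-- design back along every such p gives blocks of size v/2, and a 3-set {x, y, z} lies in the
-- pull-back of D iff {p x, p y, p z} ⊆ D.  Write w = 2m with m = n + 2.  In a 3-(2m, m, λ′)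
-- design, double counting gives the numbers of blocks through one or two points, and a triple
-- a, b, c with e coincidences among its entries (e = 0, 1 or 3) lies in N blocks with
-- N · n = λ′ (n + e m).  Summing over the r classes, a pair of distinct points shares a part in
-- exactly λ classes, so every 3-set lies in μ new blocks with μ n = λ′ (r n + 3 λ m).

open import Defs
open import Data.Nat using (ℕ; zero; suc; _+_; _*_; _∸_; _≤_; _<_; _/_; z≤n; s≤s; NonZero; >-nonZero; >-nonZero⁻¹)
open import Data.Nat.Properties hiding (_≟_)
open import Data.Nat.DivMod using (m*n/n≡m)
open import Data.Nat.Divisibility using (_∣_; divides)
open import Data.Nat.Tactic.RingSolver using (solve-∀)
open import Algebra.Properties.Semiring.Sum +-*-semiring
  using (sum-syntax; sum-cong-≗; sum-replicate-zero; ∑-comm; ∑-distrib-+; *-distribˡ-sum; *-distribʳ-sum)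
open import Algebra.Properties.CommutativeSemigroup +-commutativeSemigroup using (x∙yz≈y∙xz)
open import Data.Bool using (true; false; if_then_else_)
open import Data.Fin using (Fin; zero; suc)
open import Data.Fin.Properties using (_≟_)
import Data.Fin.Properties as Finₚ
open import Data.Fin.Subset using (Subset; inside; outside; ⁅_⁆; _∪_; ∁; ∣_∣; _∈_; _∉_; _⊆_) renaming (⊥ to ∅)
open import Data.Fin.Subset.Properties
  using ( _∈?_; _⊆?_; drop-there; ∪⇔⊎; p⊆p∪q; q⊆p∪q; x∈p∪q⁺; x∈p∩q⁺; ∉⊥; x∈⁅x⁆; x∈⁅y⁆⇔x≡y; x∈⁅y⁆⇒x≡y
        ; x≢y⇒x∉⁅y⁆; x∉⁅y⁆⇒x≢y; ∣⁅x⁆∣≡1; ∣∁p∣≡n∸∣p∣; ⊆-antisym; ⊆-refl; ∪-identityˡ; ∪-idem; ∩-comm)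
open import Data.Vec using ([]; _∷_; here; there; tabulate; lookup)
open import Data.Vec.Properties using ([]=⇒lookup; lookup⇒[]=; lookup∘tabulate)
open import Data.List using (List; []; _∷_; _++_; length; filter; map; concat; concatMap)
import Data.List as List
open import Data.List.Properties using (filter-++; length-++; length-map; tabulate-cong)
open import Data.List.Relation.Unary.All as All using (All; []; _∷_)
open import Data.List.Relation.Unary.All.Properties using (concat⁻; concat⁺; map⁺) renaming (tabulate⁻ to All-tabulate⁻)
open import Data.List.Relation.Unary.AllPairs using (AllPairs; []; _∷_)
open import Data.List.Relation.Binary.Permutation.Propositional using (_↭_; ↭-sym)
open import Data.List.Relation.Binary.Permutation.Propositional.Properties using (filter-↭; ↭-length; All-resp-↭)
open import Data.Product using (Σ; ∃; _×_; _,_; proj₁; proj₂)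
open import Data.Product.Function.NonDependent.Propositional using (_×-⇔_)
open import Data.Sum using (inj₁; inj₂; [_,_]′)
open import Function using (_∘_; _⇔_; mk⇔; Equivalence)
import Function.Properties.Equivalence as ⇔
open import Relation.Binary.Definitions using (Symmetric)
open import Relation.Binary.PropositionalEquality using (_≡_; _≢_; refl; sym; trans; cong; cong₂; subst; subst₂; module ≡-Reasoning)
open import Relation.Nullary using (Dec; yes; no; does; ¬_; contradiction)
open import Relation.Nullary.Decidable using (does-⇔; dec-false; _×-dec_)
open import Relation.Unary using (Decidable)

⟦_⟧ : ∀ {p} {P : Set p} → Dec P → ℕ
⟦ P? ⟧ = if does P? then 1 else 0

⟦⟧-cong : ∀ {p q} {P : Set p} {Q : Set q} → P ⇔ Q → (P? : Dec P) (Q? : Dec Q) → ⟦ P? ⟧ ≡ ⟦ Q? ⟧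
⟦⟧-cong P⇔Q P? Q? = cong (if_then 1 else 0) (does-⇔ P⇔Q P? Q?)

⟦⟧-no : ∀ {p} {P : Set p} → ¬ P → (P? : Dec P) → ⟦ P? ⟧ ≡ 0
⟦⟧-no ¬P P? = cong (if_then 1 else 0) (dec-false P? ¬P)

⟦⟧-×-dec : ∀ {p q} {P : Set p} {Q : Set q} (P? : Dec P) (Q? : Dec Q) → ⟦ P? ×-dec Q? ⟧ ≡ ⟦ P? ⟧ * ⟦ Q? ⟧
⟦⟧-×-dec P? Q? with does P? | does Q?
... | false | _     = refl
... | true  | false = refl
... | true  | true  = refl

∑-const : ∀ n c → ∑[ i < n ] c ≡ n * c
∑-const zero    c = refl
∑-const (suc n) c = cong (c +_) (∑-const n c)

∑-mono-≤ : ∀ {n} {f g : Fin n → ℕ} → (∀ i → f i ≤ g i) → ∑[ i < n ] f i ≤ ∑[ i < n ] g i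
∑-mono-≤ {zero}  f≤g = z≤n
∑-mono-≤ {suc n} f≤g = +-mono-≤ (f≤g zero) (∑-mono-≤ (f≤g ∘ suc))

+-≤-≡⇒≡ : ∀ {a b c d} → a ≤ b → c ≤ d → a + c ≡ b + d → a ≡ b × c ≡ d
+-≤-≡⇒≡ {a} {b} {c} {d} a≤b c≤d eq = a≡b , +-cancelˡ-≡ a c d (trans eq (cong (_+ d) (sym a≡b)))
  where
  a≡b : a ≡ b
  a≡b = ≤-antisym a≤b (+-cancelʳ-≤ c b a (≤-trans (+-monoʳ-≤ b c≤d) (≤-reflexive (sym eq))))

≤-∑≡⇒≡ : ∀ {n} {f g : Fin n → ℕ} → (∀ i → f i ≤ g i) →
         ∑[ i < n ] f i ≡ ∑[ i < n ] g i → ∀ i → f i ≡ g i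
≤-∑≡⇒≡ f≤g eq zero    = proj₁ (+-≤-≡⇒≡ (f≤g zero) (∑-mono-≤ (f≤g ∘ suc)) eq)
≤-∑≡⇒≡ f≤g eq (suc i) = ≤-∑≡⇒≡ (f≤g ∘ suc) (proj₂ (+-≤-≡⇒≡ (f≤g zero) (∑-mono-≤ (f≤g ∘ suc)) eq)) i

∑⟦⟧≤1 : ∀ {n p} {P : Fin n → Set p} (P? : Decidable P) → (∀ {i j} → P i → P j → i ≡ j) →
        ∑[ i < n ] ⟦ P? i ⟧ ≤ 1
∑⟦⟧≤1 {zero}  P? unique = z≤n
∑⟦⟧≤1 {suc n} P? unique with P? zero
... | yes P0 = ≤-reflexive (cong suc (trans (sum-cong-≗ none) (sum-replicate-zero n)))
  where
  none : ∀ i → ⟦ P? (suc i) ⟧ ≡ 0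
  none i = ⟦⟧-no (Finₚ.0≢1+n ∘ unique P0) (P? (suc i))
... | no _   = ∑⟦⟧≤1 (P? ∘ suc) (λ Pi Pj → Finₚ.suc-injective (unique Pi Pj))

∑⟦⟧≢0⇒∃ : ∀ {n p} {P : Fin n → Set p} (P? : Decidable P) → ∑[ i < n ] ⟦ P? i ⟧ ≢ 0 → ∃ P
∑⟦⟧≢0⇒∃ {n} P? ∑≢0 with Finₚ.any? P?
... | yes ∃P = ∃P
... | no ∄P  = contradiction (trans (sum-cong-≗ none) (sum-replicate-zero n)) ∑≢0
  where
  none : ∀ i → ⟦ P? i ⟧ ≡ 0
  none i = ⟦⟧-no (∄P ∘ (i ,_)) (P? i)

∑-δ : ∀ {n} (a : Fin n) (g : Fin n → ℕ) → ∑[ j < n ] (⟦ a ≟ j ⟧ * g j) ≡ g a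
∑-δ {suc n} zero    g = trans (cong₂ _+_ (+-identityʳ (g zero)) (sum-replicate-zero n)) (+-identityʳ (g zero))
∑-δ {suc n} (suc a) g = ∑-δ a (g ∘ suc)

∑-split : ∀ {n} (T : Subset n) (f : Fin n → ℕ) {a b} →
          (∀ {i} → i ∈ T → f i ≡ a) → (∀ {i} → i ∉ T → f i ≡ b) →
          ∑[ i < n ] f i ≡ ∣ T ∣ * a + ∣ ∁ T ∣ * b
∑-split []            f         fᵢₙ fₒᵤₜ = refl
∑-split (inside ∷ T)  f {a} {b} fᵢₙ fₒᵤₜ = trans
  (cong₂ _+_ (fᵢₙ here) (∑-split T (f ∘ suc) (fᵢₙ ∘ there) (λ i∉T → fₒᵤₜ (i∉T ∘ drop-there))))
  (sym (+-assoc a (∣ T ∣ * a) (∣ ∁ T ∣ * b)))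
∑-split (outside ∷ T) f {a} {b} fᵢₙ fₒᵤₜ = trans
  (cong₂ _+_ (fₒᵤₜ λ ()) (∑-split T (f ∘ suc) (fᵢₙ ∘ there) (λ i∉T → fₒᵤₜ (i∉T ∘ drop-there))))
  (x∙yz≈y∙xz b (∣ T ∣ * a) (∣ ∁ T ∣ * b))

∣p∣≡∑∈ : ∀ {n} (p : Subset n) → ∣ p ∣ ≡ ∑[ i < n ] ⟦ i ∈? p ⟧
∣p∣≡∑∈ []            = refl
∣p∣≡∑∈ (inside ∷ p)  = cong suc (∣p∣≡∑∈ p)
∣p∣≡∑∈ (outside ∷ p) = ∣p∣≡∑∈ p

∪⊆⇔ : ∀ {n} {p q r : Subset n} → p ∪ q ⊆ r ⇔ (p ⊆ r × q ⊆ r)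
∪⊆⇔ {p = p} {q} = mk⇔
  (λ p∪q⊆r → (λ {_} x∈p → p∪q⊆r (p⊆p∪q q x∈p)) , (λ {_} x∈q → p∪q⊆r (q⊆p∪q p q x∈q)))
  (λ (p⊆r , q⊆r) {_} x∈p∪q → [ (λ x∈p → p⊆r x∈p) , (λ x∈q → q⊆r x∈q) ]′ (Equivalence.to ∪⇔⊎ x∈p∪q))

⁅⁆⊆⇔ : ∀ {n} {x : Fin n} {r : Subset n} → ⁅ x ⁆ ⊆ r ⇔ x ∈ r
⁅⁆⊆⇔ {x = x} = mk⇔ (λ x⊆r → x⊆r (x∈⁅x⁆ x)) (λ x∈r {_} y∈x → subst (_∈ _) (sym (x∈⁅y⁆⇒x≡y x y∈x)) x∈r)

⁅x⁆∪p⊆q⇔ : ∀ {n} {x : Fin n} {p q : Subset n} → ⁅ x ⁆ ∪ p ⊆ q ⇔ (x ∈ q × p ⊆ q)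
⁅x⁆∪p⊆q⇔ = ⇔.trans ∪⊆⇔ (⁅⁆⊆⇔ ×-⇔ ⇔.refl)

⁅x⁆∪p≡p : ∀ {n} {x : Fin n} {p : Subset n} → x ∈ p → ⁅ x ⁆ ∪ p ≡ p
⁅x⁆∪p≡p {p = p} x∈p = ⊆-antisym (Equivalence.from ⁅x⁆∪p⊆q⇔ (x∈p , ⊆-refl)) (q⊆p∪q _ p)

∣⁅x⁆∪p∣≡1+∣p∣ : ∀ {n} {x : Fin n} {p : Subset n} → x ∉ p → ∣ ⁅ x ⁆ ∪ p ∣ ≡ suc ∣ p ∣
∣⁅x⁆∪p∣≡1+∣p∣ {x = zero}  {inside ∷ p}  x∉p = contradiction here x∉p
∣⁅x⁆∪p∣≡1+∣p∣ {x = zero}  {outside ∷ p} x∉p = cong (suc ∘ ∣_∣) (∪-identityˡ p)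
∣⁅x⁆∪p∣≡1+∣p∣ {x = suc x} {inside ∷ p}  x∉p = cong suc (∣⁅x⁆∪p∣≡1+∣p∣ (x∉p ∘ there))
∣⁅x⁆∪p∣≡1+∣p∣ {x = suc x} {outside ∷ p} x∉p = ∣⁅x⁆∪p∣≡1+∣p∣ (x∉p ∘ there)

∣⁅x⁆∪⁅y⁆∣≡2 : ∀ {n} {x y : Fin n} → x ≢ y → ∣ ⁅ x ⁆ ∪ ⁅ y ⁆ ∣ ≡ 2
∣⁅x⁆∪⁅y⁆∣≡2 {y = y} x≢y = trans (∣⁅x⁆∪p∣≡1+∣p∣ (x≢y⇒x∉⁅y⁆ x≢y)) (cong suc (∣⁅x⁆∣≡1 y))

x∉⁅y⁆∪⁅z⁆ : ∀ {n} {x y z : Fin n} → x ≢ y → x ≢ z → x ∉ ⁅ y ⁆ ∪ ⁅ z ⁆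
x∉⁅y⁆∪⁅z⁆ {y = y} {z} x≢y x≢z x∈ =
  [ x≢y ∘ x∈⁅y⁆⇒x≡y y , x≢z ∘ x∈⁅y⁆⇒x≡y z ]′ (Equivalence.to ∪⇔⊎ x∈)

record DistinctTriple (n : ℕ) : Set where
  field
    x y z : Fin n
    x≢y   : x ≢ y
    x≢z   : x ≢ z
    y≢z   : y ≢ z

  subset : Subset n
  subset = ⁅ x ⁆ ∪ ⁅ y ⁆ ∪ ⁅ z ⁆

  ∣subset∣≡3 : ∣ subset ∣ ≡ 3
  ∣subset∣≡3 = trans (∣⁅x⁆∪p∣≡1+∣p∣ (x∉⁅y⁆∪⁅z⁆ x≢y x≢z)) (cong suc (∣⁅x⁆∪⁅y⁆∣≡2 y≢z))

distinct-triple : ∀ {n} → 3 ≤ n → DistinctTriple n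
distinct-triple (s≤s (s≤s (s≤s _))) =
  record { x = zero ; y = suc zero ; z = suc (suc zero) ; x≢y = λ () ; x≢z = λ () ; y≢z = λ () }

∣p∣≡0⇒p≡∅ : ∀ {n} {p : Subset n} → ∣ p ∣ ≡ 0 → p ≡ ∅
∣p∣≡0⇒p≡∅ {p = []}          _  = refl
∣p∣≡0⇒p≡∅ {p = outside ∷ p} eq = cong (outside ∷_) (∣p∣≡0⇒p≡∅ eq)

∣p∣≡1⇒singleton : ∀ {n} {p : Subset n} → ∣ p ∣ ≡ 1 → ∃ λ x → p ≡ ⁅ x ⁆
∣p∣≡1⇒singleton {p = inside ∷ p}  eq = zero , cong (inside ∷_) (∣p∣≡0⇒p≡∅ (suc-injective eq))
∣p∣≡1⇒singleton {p = outside ∷ p} eq with x , p≡⁅x⁆ ← ∣p∣≡1⇒singleton eq =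
  suc x , cong (outside ∷_) p≡⁅x⁆

∣p∣≡2⇒pair : ∀ {n} {p : Subset n} → ∣ p ∣ ≡ 2 →
             ∃ λ x → ∃ λ y → x ≢ y × p ≡ ⁅ x ⁆ ∪ ⁅ y ⁆
∣p∣≡2⇒pair {p = inside ∷ p}  eq with y , p≡⁅y⁆ ← ∣p∣≡1⇒singleton (suc-injective eq) =
  zero , suc y , (λ ()) , cong (inside ∷_) (trans p≡⁅y⁆ (sym (∪-identityˡ ⁅ y ⁆)))
∣p∣≡2⇒pair {p = outside ∷ p} eq with x , y , x≢y , p≡ ← ∣p∣≡2⇒pair eq =
  suc x , suc y , x≢y ∘ Finₚ.suc-injective , cong (outside ∷_) p≡

∣p∣≡3⇒triple : ∀ {n} {p : Subset n} → ∣ p ∣ ≡ 3 → Σ (DistinctTriple n) λ t → p ≡ DistinctTriple.subset t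
∣p∣≡3⇒triple {p = inside ∷ p}  eq with y , z , y≢z , p≡ ← ∣p∣≡2⇒pair (suc-injective eq) =
  record { x = zero ; y = suc y ; z = suc z ; x≢y = λ () ; x≢z = λ () ; y≢z = y≢z ∘ Finₚ.suc-injective }
  , cong (inside ∷_) (trans p≡ (sym (∪-identityˡ (⁅ y ⁆ ∪ ⁅ z ⁆))))
∣p∣≡3⇒triple {p = outside ∷ p} eq with t , p≡ ← ∣p∣≡3⇒triple eq =
  record { x = suc x ; y = suc y ; z = suc z
         ; x≢y = x≢y ∘ Finₚ.suc-injective ; x≢z = x≢z ∘ Finₚ.suc-injective ; y≢z = y≢z ∘ Finₚ.suc-injective }
  , cong (outside ∷_) p≡
  where open DistinctTriple t

count-∷ : ∀ {n} (S D : Subset n) Ds → count S (D ∷ Ds) ≡ ⟦ S ⊆? D ⟧ + count S Ds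
count-∷ S D Ds with S ⊆? D
... | yes _ = refl
... | no _  = refl

count-++ : ∀ {n} (S : Subset n) Ds Es → count S (Ds ++ Es) ≡ count S Ds + count S Es
count-++ S Ds Es = trans (cong length (filter-++ (S ⊆?_) Ds Es)) (length-++ (filter (S ⊆?_) Ds))

count-↭ : ∀ {n} (S : Subset n) {Ds Es} → Ds ↭ Es → count S Ds ≡ count S Es
count-↭ S Ds↭Es = ↭-length (filter-↭ (S ⊆?_) Ds↭Es)

count-tabulate : ∀ {n w} (S : Subset n) (C : Fin w → Subset n) →
                 count S (List.tabulate C) ≡ ∑[ j < w ] ⟦ S ⊆? C j ⟧
count-tabulate {w = zero}  S C = refl
count-tabulate {w = suc w} S C =
  trans (count-∷ S (C zero) _) (cong (⟦ S ⊆? C zero ⟧ +_) (count-tabulate S (C ∘ suc)))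

count-map : ∀ {n m} (S : Subset n) (T : Subset m) (f : Subset m → Subset n) →
            (∀ D → S ⊆ f D ⇔ T ⊆ D) → ∀ Ds → count S (map f Ds) ≡ count T Ds
count-map S T f S⊆fD⇔T⊆D []       = refl
count-map S T f S⊆fD⇔T⊆D (D ∷ Ds) = begin
  count S (f D ∷ map f Ds)          ≡⟨ count-∷ S (f D) (map f Ds) ⟩
  ⟦ S ⊆? f D ⟧ + count S (map f Ds) ≡⟨ cong₂ _+_ (⟦⟧-cong (S⊆fD⇔T⊆D D) (S ⊆? f D) (T ⊆? D)) (count-map S T f S⊆fD⇔T⊆D Ds) ⟩
  ⟦ T ⊆? D ⟧ + count T Ds           ≡⟨ count-∷ T D Ds ⟨
  count T (D ∷ Ds)                  ∎
  where open ≡-Reasoning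

∑⟦⁅c⁆∪T⊆D⟧ : ∀ {n} (T D : Subset n) → ∑[ c < n ] ⟦ ⁅ c ⁆ ∪ T ⊆? D ⟧ ≡ ∣ D ∣ * ⟦ T ⊆? D ⟧
∑⟦⁅c⁆∪T⊆D⟧ {n} T D = begin
  ∑[ c < n ] ⟦ ⁅ c ⁆ ∪ T ⊆? D ⟧               ≡⟨ sum-cong-≗ (λ c → ⟦⟧-cong ⁅x⁆∪p⊆q⇔ (⁅ c ⁆ ∪ T ⊆? D) ((c ∈? D) ×-dec (T ⊆? D))) ⟩
  ∑[ c < n ] ⟦ (c ∈? D) ×-dec (T ⊆? D) ⟧     ≡⟨ sum-cong-≗ (λ c → ⟦⟧-×-dec (c ∈? D) (T ⊆? D)) ⟩
  ∑[ c < n ] (⟦ c ∈? D ⟧ * ⟦ T ⊆? D ⟧)       ≡⟨ *-distribʳ-sum ⟦ T ⊆? D ⟧ (λ c → ⟦ c ∈? D ⟧) ⟨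
  (∑[ c < n ] ⟦ c ∈? D ⟧) * ⟦ T ⊆? D ⟧       ≡⟨ cong (_* ⟦ T ⊆? D ⟧) (∣p∣≡∑∈ D) ⟨
  ∣ D ∣ * ⟦ T ⊆? D ⟧                         ∎
  where open ≡-Reasoning

-- Double counting the pairs (c, B) with ⁅ c ⁆ ∪ T ⊆ B: each block B ⊇ T yields ∣ B ∣ of them.
∑-count-extend : ∀ {n K} (T : Subset n) {Ds} → All (λ B → ∣ B ∣ ≡ K) Ds →
                 ∑[ c < n ] count (⁅ c ⁆ ∪ T) Ds ≡ K * count T Ds
∑-count-extend {n} {K} T {[]}     []             = trans (sum-replicate-zero n) (sym (*-zeroʳ K))
∑-count-extend {n} {K} T {D ∷ Ds} (∣D∣≡K ∷ ∣Ds∣≡K) = begin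
  ∑[ c < n ] count (⁅ c ⁆ ∪ T) (D ∷ Ds)
    ≡⟨ sum-cong-≗ (λ c → count-∷ (⁅ c ⁆ ∪ T) D Ds) ⟩
  ∑[ c < n ] (⟦ ⁅ c ⁆ ∪ T ⊆? D ⟧ + count (⁅ c ⁆ ∪ T) Ds)
    ≡⟨ ∑-distrib-+ (λ c → ⟦ ⁅ c ⁆ ∪ T ⊆? D ⟧) (λ c → count (⁅ c ⁆ ∪ T) Ds) ⟩
  ∑[ c < n ] ⟦ ⁅ c ⁆ ∪ T ⊆? D ⟧ + ∑[ c < n ] count (⁅ c ⁆ ∪ T) Ds
    ≡⟨ cong₂ _+_ (trans (∑⟦⁅c⁆∪T⊆D⟧ T D) (cong (_* ⟦ T ⊆? D ⟧) ∣D∣≡K)) (∑-count-extend T ∣Ds∣≡K) ⟩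
  K * ⟦ T ⊆? D ⟧ + K * count T Ds
    ≡⟨ *-distribˡ-+ K ⟦ T ⊆? D ⟧ (count T Ds) ⟨
  K * (⟦ T ⊆? D ⟧ + count T Ds)
    ≡⟨ cong (K *_) (count-∷ T D Ds) ⟨
  K * count T (D ∷ Ds)
    ∎
  where open ≡-Reasoning

-- Block counts in a 3-(2m, m, λ′) design, m = 2 + n

coincidences : ∀ {n} → Fin n → Fin n → Fin n → ℕ
coincidences a b c = ⟦ a ≟ b ⟧ + ⟦ a ≟ c ⟧ + ⟦ b ≟ c ⟧

module ThreeDesignOnDoubledSet {n lam′ : ℕ} (𝒟 : TDesign 3 ((2 + n) * 2) (2 + n) lam′) where

  open TDesign 𝒟

  count-pair : ∀ {a b} → a ≢ b → count (⁅ a ⁆ ∪ ⁅ b ⁆) blocks * n ≡ lam′ * (n + (2 + n))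
  count-pair {a} {b} a≢b = pair-arithmetic (count T blocks) (begin
    count T blocks * (2 + n)                  ≡⟨ *-comm (count T blocks) (2 + n) ⟩
    (2 + n) * count T blocks                  ≡⟨ ∑-count-extend T blockSize ⟨
    ∑[ c < (2 + n) * 2 ] count (⁅ c ⁆ ∪ T) blocks
      ≡⟨ ∑-split T _ (λ c∈T → cong (λ S → count S blocks) (⁅x⁆∪p≡p c∈T))
                     (λ c∉T → balance _ (trans (∣⁅x⁆∪p∣≡1+∣p∣ c∉T) (cong suc ∣T∣≡2))) ⟩
    ∣ T ∣ * count T blocks + ∣ ∁ T ∣ * lam′
      ≡⟨ cong₂ (λ s t → s * count T blocks + t * lam′) ∣T∣≡2 (trans (∣∁p∣≡n∸∣p∣ T) (cong (_ ∸_) ∣T∣≡2)) ⟩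
    2 * count T blocks + (1 + n) * 2 * lam′   ∎)
    where
    open ≡-Reasoning
    T : Subset ((2 + n) * 2)
    T = ⁅ a ⁆ ∪ ⁅ b ⁆
    ∣T∣≡2 : ∣ T ∣ ≡ 2
    ∣T∣≡2 = ∣⁅x⁆∪⁅y⁆∣≡2 a≢b
    pair-arithmetic : ∀ c → c * (2 + n) ≡ 2 * c + (1 + n) * 2 * lam′ → c * n ≡ lam′ * (n + (2 + n))
    pair-arithmetic c eq = trans (+-cancelˡ-≡ (2 * c) _ _ (trans (split c n) eq)) (regroup n lam′)
      where
      split : ∀ c n → 2 * c + c * n ≡ c * (2 + n)
      split = solve-∀
      regroup : ∀ n l → (1 + n) * 2 * l ≡ l * (n + (2 + n))
      regroup = solve-∀

  count-point : ∀ a → count ⁅ a ⁆ blocks * n ≡ lam′ * (n + 3 * (2 + n))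
  count-point a = point-arithmetic (count ⁅ a ⁆ blocks * n) (begin
    count ⁅ a ⁆ blocks * n * (2 + n)                 ≡⟨ reorder (count ⁅ a ⁆ blocks) n ⟩
    (2 + n) * count ⁅ a ⁆ blocks * n                 ≡⟨ cong (_* n) (∑-count-extend ⁅ a ⁆ blockSize) ⟨
    (∑[ c < (2 + n) * 2 ] count (⁅ c ⁆ ∪ ⁅ a ⁆) blocks) * n
      ≡⟨ *-distribʳ-sum n (λ c → count (⁅ c ⁆ ∪ ⁅ a ⁆) blocks) ⟩
    ∑[ c < (2 + n) * 2 ] (count (⁅ c ⁆ ∪ ⁅ a ⁆) blocks * n)
      ≡⟨ ∑-split ⁅ a ⁆ _ (λ c∈a → cong (λ S → count S blocks * n) (⁅x⁆∪p≡p c∈a))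
                         (λ c∉a → count-pair (x∉⁅y⁆⇒x≢y c∉a)) ⟩
    ∣ ⁅ a ⁆ ∣ * (count ⁅ a ⁆ blocks * n) + ∣ ∁ ⁅ a ⁆ ∣ * (lam′ * (n + (2 + n)))
      ≡⟨ cong₂ (λ s t → s * (count ⁅ a ⁆ blocks * n) + t * (lam′ * (n + (2 + n))))
               (∣⁅x⁆∣≡1 a) (trans (∣∁p∣≡n∸∣p∣ ⁅ a ⁆) (cong (_ ∸_) (∣⁅x⁆∣≡1 a))) ⟩
    1 * (count ⁅ a ⁆ blocks * n) + (1 + (1 + n) * 2) * (lam′ * (n + (2 + n)))  ∎)
    where
    open ≡-Reasoning
    reorder : ∀ c n → c * n * (2 + n) ≡ (2 + n) * c * n
    reorder = solve-∀
    point-arithmetic : ∀ c → c * (2 + n) ≡ 1 * c + (1 + (1 + n) * 2) * (lam′ * (n + (2 + n))) →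
                       c ≡ lam′ * (n + 3 * (2 + n))
    point-arithmetic c eq = *-cancelʳ-≡ c _ (1 + n) (trans (+-cancelˡ-≡ (1 * c) _ _ (trans (split c n) eq)) (regroup n lam′))
      where
      split : ∀ c n → 1 * c + c * (1 + n) ≡ c * (2 + n)
      split = solve-∀
      regroup : ∀ n l → (1 + (1 + n) * 2) * (l * (n + (2 + n))) ≡ l * (n + 3 * (2 + n)) * (1 + n)
      regroup = solve-∀

  private
    count-≡ : ∀ {S T} → S ≡ T → count S blocks * n ≡ count T blocks * n
    count-≡ = cong (λ S → count S blocks * n)

    count-pair′ : ∀ {a b} → a ≢ b → count (⁅ a ⁆ ∪ ⁅ b ⁆) blocks * n ≡ lam′ * (n + 1 * (2 + n))
    count-pair′ a≢b = trans (count-pair a≢b) (cong (λ m → lam′ * (n + m)) (sym (*-identityˡ (2 + n))))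

  count-triple : ∀ a b c → count (⁅ a ⁆ ∪ ⁅ b ⁆ ∪ ⁅ c ⁆) blocks * n ≡ lam′ * (n + coincidences a b c * (2 + n))
  count-triple a b c with a ≟ b | a ≟ c | b ≟ c
  ... | yes refl | yes refl | yes _    = trans (count-≡ (trans (cong (⁅ a ⁆ ∪_) (∪-idem ⁅ a ⁆)) (∪-idem ⁅ a ⁆))) (count-point a)
  ... | yes refl | yes refl | no  a≢a  = contradiction refl a≢a
  ... | yes refl | no  a≢c  | yes a≡c  = contradiction a≡c a≢c
  ... | yes refl | no  a≢c  | no  _    = trans (count-≡ (⁅x⁆∪p≡p (x∈p∪q⁺ (inj₁ (x∈⁅x⁆ a))))) (count-pair′ a≢c)
  ... | no  a≢b  | yes refl | yes b≡a  = contradiction (sym b≡a) a≢b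
  ... | no  a≢b  | yes refl | no  _    = trans (count-≡ (⁅x⁆∪p≡p (x∈p∪q⁺ (inj₂ (x∈⁅x⁆ a))))) (count-pair′ (a≢b ∘ sym))
  ... | no  a≢b  | no  _    | yes refl = trans (count-≡ (cong (⁅ a ⁆ ∪_) (∪-idem ⁅ b ⁆))) (count-pair′ a≢b)
  ... | no  a≢b  | no  a≢c  | no  b≢c  = trans (cong (_* n) (balance _ (DistinctTriple.∣subset∣≡3 t))) (cong (lam′ *_) (sym (+-identityʳ n)))
    where
    t : DistinctTriple ((2 + n) * 2)
    t = record { x = a ; y = b ; z = c ; x≢y = a≢b ; x≢z = a≢c ; y≢z = b≢c }

module _ {v w : ℕ} where

  preimage : (Fin v → Fin w) → Subset w → Subset v
  preimage p D = tabulate (λ x → lookup D (p x))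

  fibres : (Fin v → Fin w) → List (Subset v)
  fibres p = List.tabulate (λ j → preimage p ⁅ j ⁆)

  EqualFibres : ℕ → (Fin v → Fin w) → Set
  EqualFibres k p = ∀ j → ∣ preimage p ⁅ j ⁆ ∣ ≡ k

  together : List (Fin v → Fin w) → Fin v → Fin v → ℕ
  together ps x y = count (⁅ x ⁆ ∪ ⁅ y ⁆) (concatMap fibres ps)

  module _ {p : Fin v → Fin w} where

    ∈-preimage⇔ : ∀ {x D} → x ∈ preimage p D ⇔ p x ∈ D
    ∈-preimage⇔ {x} {D} = mk⇔
      (λ x∈ → lookup⇒[]= (p x) D (trans (sym (lookup∘tabulate _ x)) ([]=⇒lookup x∈)))
      (λ px∈ → lookup⇒[]= x _ (trans (lookup∘tabulate _ x) ([]=⇒lookup px∈)))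

    ∈-fibre⇔ : ∀ {x j} → x ∈ preimage p ⁅ j ⁆ ⇔ p x ≡ j
    ∈-fibre⇔ = ⇔.trans ∈-preimage⇔ x∈⁅y⁆⇔x≡y

    ⁅⁆⊆preimage⇔ : ∀ {x D} → ⁅ x ⁆ ⊆ preimage p D ⇔ ⁅ p x ⁆ ⊆ D
    ⁅⁆⊆preimage⇔ = ⇔.trans ⁅⁆⊆⇔ (⇔.trans ∈-preimage⇔ (⇔.sym ⁅⁆⊆⇔))

    ⁅⁆∪⊆preimage⇔ : ∀ {x D S T} → S ⊆ preimage p D ⇔ T ⊆ D → ⁅ x ⁆ ∪ S ⊆ preimage p D ⇔ ⁅ p x ⁆ ∪ T ⊆ D
    ⁅⁆∪⊆preimage⇔ S⇔T = ⇔.trans ⁅x⁆∪p⊆q⇔ (⇔.trans (∈-preimage⇔ ×-⇔ S⇔T) (⇔.sym ⁅x⁆∪p⊆q⇔))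

    ∑-over-fibres : ∀ (g : Fin w → ℕ) → ∑[ x < v ] g (p x) ≡ ∑[ j < w ] (∣ preimage p ⁅ j ⁆ ∣ * g j)
    ∑-over-fibres g = begin
      ∑[ x < v ] g (p x)                           ≡⟨ sum-cong-≗ (λ x → ∑-δ (p x) g) ⟨
      ∑[ x < v ] ∑[ j < w ] (⟦ p x ≟ j ⟧ * g j) ≡⟨ ∑-comm (λ x j → ⟦ p x ≟ j ⟧ * g j) ⟩
      ∑[ j < w ] ∑[ x < v ] (⟦ p x ≟ j ⟧ * g j) ≡⟨ sum-cong-≗ (λ j → *-distribʳ-sum (g j) (λ x → ⟦ p x ≟ j ⟧)) ⟨
      ∑[ j < w ] (∑[ x < v ] ⟦ p x ≟ j ⟧ * g j) ≡⟨ sum-cong-≗ (λ j → cong (_* g j) (fibre-size j)) ⟨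
      ∑[ j < w ] (∣ preimage p ⁅ j ⁆ ∣ * g j)       ∎
      where
      open ≡-Reasoning
      fibre-size : ∀ j → ∣ preimage p ⁅ j ⁆ ∣ ≡ ∑[ x < v ] ⟦ p x ≟ j ⟧
      fibre-size j = trans (∣p∣≡∑∈ (preimage p ⁅ j ⁆)) (sum-cong-≗ (λ x → ⟦⟧-cong ∈-fibre⇔ (x ∈? preimage p ⁅ j ⁆) (p x ≟ j)))

    ∣preimage∣ : ∀ {k} → EqualFibres k p → ∀ D → ∣ preimage p D ∣ ≡ ∣ D ∣ * k
    ∣preimage∣ {k} equal D = begin
      ∣ preimage p D ∣                   ≡⟨ ∣p∣≡∑∈ (preimage p D) ⟩
      ∑[ x < v ] ⟦ x ∈? preimage p D ⟧  ≡⟨ sum-cong-≗ (λ x → ⟦⟧-cong ∈-preimage⇔ (x ∈? preimage p D) (p x ∈? D)) ⟩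
      ∑[ x < v ] ⟦ p x ∈? D ⟧           ≡⟨ ∑-over-fibres (λ j → ⟦ j ∈? D ⟧) ⟩
      ∑[ j < w ] (∣ preimage p ⁅ j ⁆ ∣ * ⟦ j ∈? D ⟧) ≡⟨ sum-cong-≗ (λ j → cong (_* ⟦ j ∈? D ⟧) (equal j)) ⟩
      ∑[ j < w ] (k * ⟦ j ∈? D ⟧)       ≡⟨ *-distribˡ-sum k (λ j → ⟦ j ∈? D ⟧) ⟨
      k * ∑[ j < w ] ⟦ j ∈? D ⟧         ≡⟨ cong (k *_) (∣p∣≡∑∈ D) ⟨
      k * ∣ D ∣                          ≡⟨ *-comm k ∣ D ∣ ⟩
      ∣ D ∣ * k                          ∎
      where open ≡-Reasoning

    count-pair-fibres : ∀ x y → count (⁅ x ⁆ ∪ ⁅ y ⁆) (fibres p) ≡ ⟦ p x ≟ p y ⟧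
    count-pair-fibres x y = begin
      count (⁅ x ⁆ ∪ ⁅ y ⁆) (fibres p)
        ≡⟨ count-tabulate (⁅ x ⁆ ∪ ⁅ y ⁆) (λ j → preimage p ⁅ j ⁆) ⟩
      ∑[ j < w ] ⟦ ⁅ x ⁆ ∪ ⁅ y ⁆ ⊆? preimage p ⁅ j ⁆ ⟧
        ≡⟨ sum-cong-≗ (λ j → ⟦⟧-cong pair⊆fibre⇔ (⁅ x ⁆ ∪ ⁅ y ⁆ ⊆? preimage p ⁅ j ⁆) ((p x ≟ j) ×-dec (p y ≟ j))) ⟩
      ∑[ j < w ] ⟦ (p x ≟ j) ×-dec (p y ≟ j) ⟧
        ≡⟨ sum-cong-≗ (λ j → ⟦⟧-×-dec (p x ≟ j) (p y ≟ j)) ⟩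
      ∑[ j < w ] (⟦ p x ≟ j ⟧ * ⟦ p y ≟ j ⟧)
        ≡⟨ ∑-δ (p x) (λ j → ⟦ p y ≟ j ⟧) ⟩
      ⟦ p y ≟ p x ⟧
        ≡⟨ ⟦⟧-cong (mk⇔ sym sym) (p y ≟ p x) (p x ≟ p y) ⟩
      ⟦ p x ≟ p y ⟧
        ∎
      where
      open ≡-Reasoning
      pair⊆fibre⇔ : ∀ {j} → ⁅ x ⁆ ∪ ⁅ y ⁆ ⊆ preimage p ⁅ j ⁆ ⇔ (p x ≡ j × p y ≡ j)
      pair⊆fibre⇔ = ⇔.trans ⁅x⁆∪p⊆q⇔ (∈-fibre⇔ ×-⇔ ⇔.trans ⁅⁆⊆⇔ ∈-fibre⇔)

    together-∷ : ∀ ps x y → together (p ∷ ps) x y ≡ ⟦ p x ≟ p y ⟧ + together ps x y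
    together-∷ ps x y = trans (count-++ (⁅ x ⁆ ∪ ⁅ y ⁆) (fibres p) _) (cong (_+ together ps x y) (count-pair-fibres x y))

-- Resolution classes as fibres

-- Every point lies in at most one part and the parts have total size v, so every point lies in
-- exactly one part.
partition-fibres : ∀ {v w k} (C : Fin w → Subset v) → (∀ {i j} → i ≢ j → Disjoint (C i) (C j)) →
                   (∀ j → ∣ C j ∣ ≡ k) → w * k ≡ v → ∃ λ p → ∀ j → C j ≡ preimage p ⁅ j ⁆
partition-fibres {v} {w} {k} C disjoint size w*k≡v = p , C≡fibre
  where
  open ≡-Reasoning

  same-part : ∀ {x i j} → x ∈ C i → x ∈ C j → i ≡ j
  same-part {x} {i} {j} x∈Ci x∈Cj with i ≟ j
  ... | yes i≡j = i≡j
  ... | no  i≢j = contradiction (subst (x ∈_) (disjoint i≢j) (x∈p∩q⁺ (x∈Ci , x∈Cj))) ∉⊥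

  parts : Fin v → ℕ
  parts x = ∑[ j < w ] ⟦ x ∈? C j ⟧

  ∑parts : ∑[ x < v ] parts x ≡ ∑[ x < v ] 1
  ∑parts = begin
    ∑[ x < v ] ∑[ j < w ] ⟦ x ∈? C j ⟧ ≡⟨ ∑-comm (λ x j → ⟦ x ∈? C j ⟧) ⟩
    ∑[ j < w ] ∑[ x < v ] ⟦ x ∈? C j ⟧ ≡⟨ sum-cong-≗ (λ j → trans (sym (∣p∣≡∑∈ (C j))) (size j)) ⟩
    ∑[ j < w ] k                       ≡⟨ ∑-const w k ⟩
    w * k                              ≡⟨ w*k≡v ⟩
    v                                  ≡⟨ *-identityʳ v ⟨
    v * 1                              ≡⟨ ∑-const v 1 ⟨
    ∑[ x < v ] 1                       ∎

  covered : ∀ x → ∃ λ j → x ∈ C j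
  covered x = ∑⟦⟧≢0⇒∃ (λ j → x ∈? C j) λ parts≡0 → 1+n≢0 (trans (sym one-part) parts≡0)
    where
    one-part : parts x ≡ 1
    one-part = ≤-∑≡⇒≡ (λ x → ∑⟦⟧≤1 (λ j → x ∈? C j) same-part) ∑parts x

  p : Fin v → Fin w
  p x = proj₁ (covered x)

  C≡fibre : ∀ j → C j ≡ preimage p ⁅ j ⁆
  C≡fibre j = ⊆-antisym
    (λ x∈Cj → Equivalence.from ∈-fibre⇔ (same-part (proj₂ (covered _)) x∈Cj))
    (λ x∈fibre → subst (λ i → _ ∈ C i) (Equivalence.to ∈-fibre⇔ x∈fibre) (proj₂ (covered _)))

tabulate-of-length : ∀ {a} {A : Set a} {n} (xs : List A) → length xs ≡ n →
                     ∃ λ (f : Fin n → A) → xs ≡ List.tabulate f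
tabulate-of-length []       refl = (λ ()) , refl
tabulate-of-length (x ∷ xs) refl with f , xs≡ ← tabulate-of-length xs refl =
  (λ { zero → x ; (suc i) → f i }) , cong (x ∷_) xs≡

AllPairs-tabulate⁻ : ∀ {a r} {A : Set a} {R : A → A → Set r} {n} {f : Fin n → A} → Symmetric R →
                     AllPairs R (List.tabulate f) → ∀ {i j} → i ≢ j → R (f i) (f j)
AllPairs-tabulate⁻ R-sym (_ ∷ _)      {zero}  {zero}  i≢j = contradiction refl i≢j
AllPairs-tabulate⁻ R-sym (Rf₀ ∷ _)    {zero}  {suc j} _   = All-tabulate⁻ Rf₀ j
AllPairs-tabulate⁻ R-sym (Rf₀ ∷ _)    {suc i} {zero}  _   = R-sym (All-tabulate⁻ Rf₀ i)
AllPairs-tabulate⁻ R-sym (_ ∷ Rfsuc) {suc i} {suc j} i≢j =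
  AllPairs-tabulate⁻ R-sym Rfsuc (i≢j ∘ cong suc)

Disjoint-sym : ∀ {n} → Symmetric (Disjoint {n})
Disjoint-sym {x = B} {C} B∩C≡∅ = trans (∩-comm C B) B∩C≡∅

class-fibres : ∀ {v w k} {cls : List (Subset v)} → length cls ≡ w → AllPairs Disjoint cls →
               All (λ B → ∣ B ∣ ≡ k) cls → w * k ≡ v → ∃ λ p → cls ≡ fibres p × EqualFibres k p
class-fibres {cls = cls} len disjoint sizes w*k≡v with C , refl ← tabulate-of-length cls len
  with p , C≡fibre ← partition-fibres C (AllPairs-tabulate⁻ Disjoint-sym disjoint) (All-tabulate⁻ sizes) w*k≡v =
  p , tabulate-cong C≡fibre , λ j → trans (cong ∣_∣ (sym (C≡fibre j))) (All-tabulate⁻ sizes j)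

BIBD-k≢0 : ∀ {v b r k lam} → BIBD v b r k lam → NonZero k
BIBD-k≢0 D = >-nonZero (≤-trans (s≤s z≤n) (BIBD.k≥2 D))

resolution-fibres : ∀ {v b r k lam w} → ResolvableBIBD v b r k lam → w * k ≡ v →
  ∃ λ (ps : List (Fin v → Fin w)) → length ps ≡ r × All (EqualFibres k) ps ×
    (∀ x y → x ≢ y → together ps x y ≡ lam)
resolution-fibres {v} {r = r} {k} {lam} {w} R w*k≡v =
  ps , length-ps , equal , λ x y x≢y → begin
    count (⁅ x ⁆ ∪ ⁅ y ⁆) (concat (map fibres ps)) ≡⟨ cong (count (⁅ x ⁆ ∪ ⁅ y ⁆) ∘ concat) classes≡ ⟨
    count (⁅ x ⁆ ∪ ⁅ y ⁆) (concat classes)        ≡⟨ count-↭ (⁅ x ⁆ ∪ ⁅ y ⁆) partition ⟩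
    count (⁅ x ⁆ ∪ ⁅ y ⁆) (BIBD.blocks design)    ≡⟨ BIBD.balance design x y x≢y ⟩
    lam                                            ∎
  where
  open ≡-Reasoning
  open ResolvableBIBD R

  instance
    k≢0 : NonZero k
    k≢0 = BIBD-k≢0 design

  classes-fibres : ∀ {clss} → All (λ cls → length cls ≡ w) clss → All (AllPairs Disjoint) clss →
                   All (All (λ B → ∣ B ∣ ≡ k)) clss → ∃ λ ps → clss ≡ map fibres ps × All (EqualFibres k) ps
  classes-fibres []         []         []           = [] , refl , []
  classes-fibres (len ∷ ls) (dis ∷ ds) (sizes ∷ ss)
    with p , cls≡ , equal ← class-fibres len dis sizes w*k≡v
       | ps , clss≡ , equals ← classes-fibres ls ds ss = p ∷ ps , cong₂ _∷_ cls≡ clss≡ , equal ∷ equals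

  lengths : All (λ cls → length cls ≡ w) classes
  lengths = All.map (λ {cls} len*k≡v → *-cancelʳ-≡ (length cls) w k (trans len*k≡v (sym w*k≡v))) classSize

  sizes : All (All (λ B → ∣ B ∣ ≡ k)) classes
  sizes = concat⁻ (All-resp-↭ (↭-sym partition) (BIBD.blockSize design))

  ps : List (Fin v → Fin w)
  ps = proj₁ (classes-fibres lengths classDisj sizes)

  classes≡ : classes ≡ map fibres ps
  classes≡ = proj₁ (proj₂ (classes-fibres lengths classDisj sizes))

  equal : All (EqualFibres k) ps
  equal = proj₂ (proj₂ (classes-fibres lengths classDisj sizes))

  length-ps : length ps ≡ r
  length-ps = trans (sym (length-map fibres ps)) (trans (cong length (sym classes≡)) numClasses)

-- The pulled-back design

μ-formula : ∀ μ n r l l′ → μ * n ≡ l′ * (r * n + (2 + n) * (l + l + l)) →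
            μ * (n * 2) ≡ l′ * (3 * l * ((2 + n) * 2) + r * (n * 2))
μ-formula μ n r l l′ eq = trans (double μ n) (trans (cong (2 *_) eq) (regroup n r l l′))
  where
  double : ∀ μ n → μ * (n * 2) ≡ 2 * (μ * n)
  double = solve-∀
  regroup : ∀ n r l l′ → 2 * (l′ * (r * n + (2 + n) * (l + l + l))) ≡ l′ * (3 * l * ((2 + n) * 2) + r * (n * 2))
  regroup = solve-∀

module Pullback {n lam′ v : ℕ} (𝒟 : TDesign 3 ((2 + n) * 2) (2 + n) lam′) where

  open ThreeDesignOnDoubledSet 𝒟
  open TDesign 𝒟 using (blocks; blockSize)

  pullback : (Fin v → Fin ((2 + n) * 2)) → List (Subset v)
  pullback p = map (preimage p) blocks

  count-pullback : ∀ p x y z → count (⁅ x ⁆ ∪ ⁅ y ⁆ ∪ ⁅ z ⁆) (pullback p) ≡ count (⁅ p x ⁆ ∪ ⁅ p y ⁆ ∪ ⁅ p z ⁆) blocks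
  count-pullback p x y z = count-map _ _ (preimage p) (λ D → ⁅⁆∪⊆preimage⇔ (⁅⁆∪⊆preimage⇔ ⁅⁆⊆preimage⇔)) blocks

  count-pullbacks : ∀ ps x y z → count (⁅ x ⁆ ∪ ⁅ y ⁆ ∪ ⁅ z ⁆) (concatMap pullback ps) * n ≡
                    lam′ * (length ps * n + (2 + n) * (together ps x y + together ps x z + together ps y z))
  count-pullbacks []       x y z = sym (trans (cong (lam′ *_) (*-zeroʳ (2 + n))) (*-zeroʳ lam′))
  count-pullbacks (p ∷ ps) x y z = begin
    count S (pullback p ++ concatMap pullback ps) * n
      ≡⟨ cong (_* n) (count-++ S (pullback p) (concatMap pullback ps)) ⟩
    (count S (pullback p) + count S (concatMap pullback ps)) * n
      ≡⟨ *-distribʳ-+ n (count S (pullback p)) (count S (concatMap pullback ps)) ⟩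
    count S (pullback p) * n + count S (concatMap pullback ps) * n
      ≡⟨ cong₂ _+_ (trans (cong (_* n) (count-pullback p x y z)) (count-triple (p x) (p y) (p z))) (count-pullbacks ps x y z) ⟩
    lam′ * (n + (⟦ p x ≟ p y ⟧ + ⟦ p x ≟ p z ⟧ + ⟦ p y ≟ p z ⟧) * (2 + n)) +
    lam′ * (length ps * n + (2 + n) * (together ps x y + together ps x z + together ps y z))
      ≡⟨ regroup lam′ n (length ps) ⟦ p x ≟ p y ⟧ ⟦ p x ≟ p z ⟧ ⟦ p y ≟ p z ⟧ _ _ _ ⟩
    lam′ * (suc (length ps) * n + (2 + n) * ((⟦ p x ≟ p y ⟧ + together ps x y) +
                                             (⟦ p x ≟ p z ⟧ + together ps x z) +
                                             (⟦ p y ≟ p z ⟧ + together ps y z)))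
      ≡⟨ cong (λ t → lam′ * (suc (length ps) * n + (2 + n) * t))
              (sym (cong₂ _+_ (cong₂ _+_ (together-∷ {p = p} ps x y) (together-∷ {p = p} ps x z)) (together-∷ {p = p} ps y z))) ⟩
    lam′ * (suc (length ps) * n + (2 + n) * (together (p ∷ ps) x y + together (p ∷ ps) x z + together (p ∷ ps) y z))
      ∎
    where
    open ≡-Reasoning
    S : Subset v
    S = ⁅ x ⁆ ∪ ⁅ y ⁆ ∪ ⁅ z ⁆
    regroup : ∀ l n L a b c A B C →
              l * (n + (a + b + c) * (2 + n)) + l * (L * n + (2 + n) * (A + B + C)) ≡
              l * ((1 + L) * n + (2 + n) * ((a + A) + (b + B) + (c + C)))
    regroup = solve-∀

  pullback-design : ∀ {b r k lam} .{{_ : NonZero n}} → ResolvableBIBD v b r k lam → (2 + n) * 2 * k ≡ v →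
                    Σ ℕ λ μ → μ * (n * 2) ≡ lam′ * (3 * lam * ((2 + n) * 2) + r * (n * 2)) × TDesign 3 v (v / 2) μ
  pullback-design {r = r} {k} {lam} R v≡ = μ , μ-formula μ n r lam lam′ (count-distinct-triple reference) , record
    { blocks    = blocks′
    ; t≤k       = subst (3 ≤_) (sym v/2≡) 3≤m*k
    ; k<v       = subst₂ _<_ (sym v/2≡) (sym v≡m*k+m*k) (m<m+n _ (≤-trans (s≤s z≤n) 3≤m*k))
    ; blockSize = concat⁺ (map⁺ (All.map (λ {p} equal → map⁺ (All.map (λ {D} → ∣pullback∣ p equal D) blockSize)) equal-fibres))
    ; balance   = balance
    }
    where
    ps : List (Fin v → Fin ((2 + n) * 2))
    ps = proj₁ (resolution-fibres R v≡)

    length-ps : length ps ≡ r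
    length-ps = proj₁ (proj₂ (resolution-fibres R v≡))

    equal-fibres : All (EqualFibres k) ps
    equal-fibres = proj₁ (proj₂ (proj₂ (resolution-fibres R v≡)))

    together≡ : ∀ x y → x ≢ y → together ps x y ≡ lam
    together≡ = proj₂ (proj₂ (proj₂ (resolution-fibres R v≡)))

    instance
      k≢0 : NonZero k
      k≢0 = BIBD-k≢0 (ResolvableBIBD.design R)

    3≤m*k : 3 ≤ (2 + n) * k
    3≤m*k = ≤-trans (s≤s (s≤s (>-nonZero⁻¹ n))) (m≤m*n (2 + n) k)

    v≡m*k*2 : v ≡ (2 + n) * k * 2
    v≡m*k*2 = trans (sym v≡) (trans (*-assoc (2 + n) 2 k) (trans (cong ((2 + n) *_) (*-comm 2 k)) (sym (*-assoc (2 + n) k 2))))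

    v≡m*k+m*k : v ≡ (2 + n) * k + (2 + n) * k
    v≡m*k+m*k = trans v≡m*k*2 (trans (*-comm ((2 + n) * k) 2) (cong ((2 + n) * k +_) (+-identityʳ ((2 + n) * k))))

    v/2≡ : v / 2 ≡ (2 + n) * k
    v/2≡ = trans (cong (_/ 2) v≡m*k*2) (m*n/n≡m ((2 + n) * k) 2)

    reference : DistinctTriple v
    reference = distinct-triple (subst (3 ≤_) (sym v≡m*k+m*k) (≤-trans 3≤m*k (m≤m+n _ _)))

    ∣pullback∣ : ∀ p → EqualFibres k p → ∀ D → ∣ D ∣ ≡ 2 + n → ∣ preimage p D ∣ ≡ v / 2
    ∣pullback∣ p equal D ∣D∣≡m = trans (∣preimage∣ {p = p} equal D) (trans (cong (_* k) ∣D∣≡m) (sym v/2≡))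

    blocks′ : List (Subset v)
    blocks′ = concatMap pullback ps

    μ : ℕ
    μ = count (DistinctTriple.subset reference) blocks′

    count-distinct-triple : ∀ (t : DistinctTriple v) → count (DistinctTriple.subset t) blocks′ * n ≡
                            lam′ * (r * n + (2 + n) * (lam + lam + lam))
    count-distinct-triple t = trans (count-pullbacks ps x y z)
      (cong₂ (λ L T → lam′ * (L * n + (2 + n) * T)) length-ps
             (cong₂ _+_ (cong₂ _+_ (together≡ x y x≢y) (together≡ x z x≢z)) (together≡ y z y≢z)))
      where open DistinctTriple t

    balance : ∀ S → ∣ S ∣ ≡ 3 → count S blocks′ ≡ μ
    balance S ∣S∣≡3 with t , refl ← ∣p∣≡3⇒triple {p = S} ∣S∣≡3 =
      *-cancelʳ-≡ _ _ n (trans (count-distinct-triple t) (sym (count-distinct-triple reference)))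

corollary2p6 : (v b r k lam w lam′ : ℕ) →
    w * k ≡ v → 4 < w → 2 ∣ w →
    ResolvableBIBD v b r k lam →
    TDesign 3 w (w / 2) lam′ →
    Σ ℕ (λ μ → (μ * (w ∸ 4) ≡ lam′ * (3 * lam * w + r * (w ∸ 4)))
               × TDesign 3 v (v / 2) μ)
corollary2p6 v b r k lam ._ lam′ _ ()                         (divides 0 refl) _ _
corollary2p6 v b r k lam ._ lam′ _ (s≤s (s≤s ()))             (divides 1 refl) _ _
corollary2p6 v b r k lam ._ lam′ _ (s≤s (s≤s (s≤s (s≤s ())))) (divides 2 refl) _ _
corollary2p6 v b r k lam ._ lam′ v≡ _ (divides (suc (suc (suc h))) refl) R 𝒟 =
  Pullback.pullback-design {n = suc h} (subst (λ m → TDesign 3 ((3 + h) * 2) m lam′) (m*n/n≡m (3 + h) 2) 𝒟) R v≡
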